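{- Let $H$ be a bounded implicative semilattice. For every $a\in H$ the set $G_a=\{b\in H:\neg\neg a\wedge(b\to a)\le b\}$ is a filter of $H$. Moreover, if $H$ is finite, then $G_a$ has a minimum for every $a\in H$, i.e., there exists a $G$-function on $H$.
   Context: A bounded implicative semilattice is $(H,\wedge,\to,0,1)$ where $(H,\wedge)$ is a meet-semilattice with top $1$ and bottom $0$ and $a\wedge b\le c$ iff $a\le b\to c$; $\neg a:=a\to0$. A filter is an upset containing $1$ and closed under $\wedge$. A $G$-function on (the bounded Hilbert algebra reduct of) $H$ is a map $G:H\to H$ such that for all $a,b$: $a\le G(a)$, $G(a)\le((b\to a)\to b)\to b$, $G(a)\le\neg\neg a$, and $G(a)\to a\le\neg\neg a\to a$. -}

module Defs where

open import Level using (Level; suc; _⊔_)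
open import Data.Nat using (ℕ)
open import Data.Fin using (Fin)
open import Data.Product using (Σ; _×_; _,_)
open import Relation.Binary.PropositionalEquality using (_≡_)
open import Function.Bundles using (_↔_; _⇔_)

record BoundedImplicativeSemilattice (c : Level) : Set (suc c) where
  infixr 7 _∧_
  infixr 5 _⇒_
  infix 4 _≤_
  field
    Carrier : Set c
    _∧_     : Carrier → Carrier → Carrier
    _⇒_     : Carrier → Carrier → Carrier
    𝟘       : Carrier
    𝟙       : Carrier

  _≤_ : Carrier → Carrier → Set c
  x ≤ y = x ∧ y ≡ x

  field
    ∧-assoc : ∀ x y z → (x ∧ y) ∧ z ≡ x ∧ (y ∧ z)
    ∧-comm  : ∀ x y → x ∧ y ≡ y ∧ x
    ∧-idem  : ∀ x → x ∧ x ≡ x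
    ≤-𝟙     : ∀ x → x ≤ 𝟙
    𝟘-≤     : ∀ x → 𝟘 ≤ x
    residuation : ∀ a b c → (a ∧ b ≤ c) ⇔ (a ≤ b ⇒ c)

  ¬_ : Carrier → Carrier
  ¬ a = a ⇒ 𝟘

module _ {c : Level} (H : BoundedImplicativeSemilattice c) where
  open BoundedImplicativeSemilattice H

  record IsFilter (F : Carrier → Set c) : Set c where
    field
      upward   : ∀ {x y} → x ≤ y → F x → F y
      contains-𝟙 : F 𝟙
      ∧-closed : ∀ {x y} → F x → F y → F (x ∧ y)

  G[_] : Carrier → Carrier → Set c
  G[ a ] b = (¬ (¬ a)) ∧ (b ⇒ a) ≤ b

  IsMinimum : (Carrier → Set c) → Carrier → Set c
  IsMinimum P m = P m × (∀ b → P b → m ≤ b)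

  record IsGFunction (G : Carrier → Carrier) : Set c where
    field
      extensive : ∀ a → a ≤ G a
      peirce    : ∀ a b → G a ≤ ((b ⇒ a) ⇒ b) ⇒ b
      below-¬¬  : ∀ a → G a ≤ ¬ (¬ a)
      imp-cond  : ∀ a → (G a ⇒ a) ≤ (¬ (¬ a) ⇒ a)

  IsFinite : Set c
  IsFinite = Σ ℕ (λ n → Carrier ↔ Fin n)

module Submission where

-- The key observation is a "test" characterisation of G_a (G-intro/G-elim):
--   b ∈ G_a  iff  every z ≤ ¬¬a with z ∧ b ≤ a already satisfies z ≤ b,
-- since ¬¬a ∧ (b → a) is the largest such z.

open import Defs
open import Level using (Level)
open import Data.Product using (Σ; _×_; _,_; proj₁; proj₂)
open import Data.Fin.Properties using (inj⇒≟)
open import Data.List using (List; []; _∷_; foldr; filter; tabulate)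
open import Data.List.Relation.Unary.All using (All; []; _∷_)
open import Data.List.Relation.Unary.All.Properties using (all-filter)
open import Data.List.Relation.Unary.Any using (here; there)
open import Data.List.Membership.Propositional using (_∈_)
open import Data.List.Membership.Propositional.Properties using (∈-tabulate⁺; ∈-filter⁺)
open import Relation.Unary using (Decidable)
open import Relation.Binary.PropositionalEquality using (refl; sym; trans; cong; subst; module ≡-Reasoning)
open import Function.Bundles using (Inverse; Equivalence)
open import Function.Properties.Inverse using (↔⇒↣)

module _ {c : Level} (H : BoundedImplicativeSemilattice c) where
  open BoundedImplicativeSemilattice H renaming (¬_ to ∼_)

  ≤-refl : ∀ x → x ≤ x
  ≤-refl = ∧-idem

  ≤-trans : ∀ {x y z} → x ≤ y → y ≤ z → x ≤ z
  ≤-trans {x} {y} {z} x≤y y≤z = begin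
    x ∧ z        ≡⟨ cong (_∧ z) (sym x≤y) ⟩
    (x ∧ y) ∧ z  ≡⟨ ∧-assoc x y z ⟩
    x ∧ (y ∧ z)  ≡⟨ cong (x ∧_) y≤z ⟩
    x ∧ y        ≡⟨ x≤y ⟩
    x            ∎
    where open ≡-Reasoning

  ∧-lowerˡ : ∀ x y → x ∧ y ≤ x
  ∧-lowerˡ x y = begin
    (x ∧ y) ∧ x  ≡⟨ ∧-assoc x y x ⟩
    x ∧ (y ∧ x)  ≡⟨ cong (x ∧_) (∧-comm y x) ⟩
    x ∧ (x ∧ y)  ≡⟨ sym (∧-assoc x x y) ⟩
    (x ∧ x) ∧ y  ≡⟨ cong (_∧ y) (∧-idem x) ⟩
    x ∧ y        ∎
    where open ≡-Reasoning

  ∧-lowerʳ : ∀ x y → x ∧ y ≤ y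
  ∧-lowerʳ x y = trans (∧-assoc x y y) (cong (x ∧_) (∧-idem y))

  ∧-greatest : ∀ {z x y} → z ≤ x → z ≤ y → z ≤ x ∧ y
  ∧-greatest {z} {x} {y} z≤x z≤y = trans (sym (∧-assoc z x y)) (trans (cong (_∧ y) z≤x) z≤y)

  ∧-mono : ∀ {x y x′ y′} → x ≤ x′ → y ≤ y′ → x ∧ y ≤ x′ ∧ y′
  ∧-mono {x} {y} x≤x′ y≤y′ =
    ∧-greatest (≤-trans (∧-lowerˡ x y) x≤x′) (≤-trans (∧-lowerʳ x y) y≤y′)

  curry : ∀ {x y z} → x ∧ y ≤ z → x ≤ y ⇒ z
  curry {x} {y} {z} = Equivalence.to (residuation x y z)

  uncurry : ∀ {x y z} → x ≤ y ⇒ z → x ∧ y ≤ z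
  uncurry {x} {y} {z} = Equivalence.from (residuation x y z)

  modus-ponens : ∀ x y → (x ⇒ y) ∧ x ≤ y
  modus-ponens x y = uncurry (≤-refl (x ⇒ y))

  modus-ponens′ : ∀ x y → x ∧ (x ⇒ y) ≤ y
  modus-ponens′ x y = subst (_≤ y) (∧-comm (x ⇒ y) x) (modus-ponens x y)

  weaken : ∀ x y → x ≤ y ⇒ x
  weaken x y = curry (∧-lowerˡ x y)

  ≤-¬¬ : ∀ x → x ≤ ∼ (∼ x)
  ≤-¬¬ x = curry (modus-ponens′ x 𝟘)

  G-elim : ∀ {a b z} → G[ H ] a b → z ≤ ∼ (∼ a) → z ∧ b ≤ a → z ≤ b
  G-elim b∈G z≤¬¬a z∧b≤a = ≤-trans (∧-greatest z≤¬¬a (curry z∧b≤a)) b∈G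

  G-intro : ∀ {a b} → (∀ {z} → z ≤ ∼ (∼ a) → z ∧ b ≤ a → z ≤ b) → G[ H ] a b
  G-intro {a} {b} test = test (∧-lowerˡ _ _) test-premise
    where
      test-premise : (∼ (∼ a) ∧ (b ⇒ a)) ∧ b ≤ a
      test-premise = ≤-trans (∧-mono (∧-lowerʳ (∼ (∼ a)) (b ⇒ a)) (≤-refl b)) (modus-ponens b a)

  -- If b ∈ G_a then any test element z with z ∧ b ∧ d ≤ a passes the
  -- test for d as well; this is the heart of closure under ∧.
  G-absorb : ∀ {a b d z} → G[ H ] a b → z ≤ ∼ (∼ a) → z ∧ (b ∧ d) ≤ a → z ∧ d ≤ a
  G-absorb {a} {b} {d} {z} b∈G z≤¬¬a z∧bd≤a = ≤-trans z∧d≤z∧bd z∧bd≤a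
    where
      z∧d≤b : z ∧ d ≤ b
      z∧d≤b = G-elim b∈G (≤-trans (∧-lowerˡ z d) z≤¬¬a)
        (≤-trans (∧-greatest (≤-trans (∧-lowerˡ _ b) (∧-lowerˡ z d))
                             (∧-greatest (∧-lowerʳ _ b) (≤-trans (∧-lowerˡ _ b) (∧-lowerʳ z d))))
                 z∧bd≤a)
      z∧d≤z∧bd : z ∧ d ≤ z ∧ (b ∧ d)
      z∧d≤z∧bd = ∧-greatest (∧-lowerˡ z d) (∧-greatest z∧d≤b (∧-lowerʳ z d))

  G-filter : ∀ a → IsFilter H (G[ H ] a)
  G-filter a = record { upward = upward ; contains-𝟙 = ≤-𝟙 _ ; ∧-closed = ∧-closed }
    where
      upward : ∀ {b d} → b ≤ d → G[ H ] a b → G[ H ] a d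
      upward b≤d b∈G = G-intro λ z≤¬¬a z∧d≤a →
        ≤-trans (G-elim b∈G z≤¬¬a (≤-trans (∧-mono (≤-refl _) b≤d) z∧d≤a)) b≤d

      ∧-closed : ∀ {b d} → G[ H ] a b → G[ H ] a d → G[ H ] a (b ∧ d)
      ∧-closed {b} {d} b∈G d∈G = G-intro λ z≤¬¬a z∧bd≤a →
        ∧-greatest
          (G-elim b∈G z≤¬¬a (G-absorb d∈G z≤¬¬a (subst (λ e → _ ∧ e ≤ a) (∧-comm b d) z∧bd≤a)))
          (G-elim d∈G z≤¬¬a (G-absorb b∈G z≤¬¬a z∧bd≤a))

  ⋀ : List Carrier → Carrier
  ⋀ = foldr _∧_ 𝟙

  ⋀-lower : ∀ {x} xs → x ∈ xs → ⋀ xs ≤ x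
  ⋀-lower (x ∷ xs) (here refl) = ∧-lowerˡ x (⋀ xs)
  ⋀-lower (y ∷ xs) (there x∈xs) = ≤-trans (∧-lowerʳ y (⋀ xs)) (⋀-lower xs x∈xs)

  ⋀-filter : ∀ {F} → IsFilter H F → ∀ {xs} → All F xs → F (⋀ xs)
  ⋀-filter F-filter []           = IsFilter.contains-𝟙 F-filter
  ⋀-filter F-filter (Fx ∷ Fxs) = IsFilter.∧-closed F-filter Fx (⋀-filter F-filter Fxs)

  filter-minimum : ∀ {F} → IsFilter H F → Decidable F
    → (xs : List Carrier) → (∀ x → x ∈ xs)
    → Σ Carrier (IsMinimum H F)
  filter-minimum F-filter F? xs complete =
      ⋀ members
    , ⋀-filter F-filter (all-filter F? xs)
    , λ b Fb → ⋀-lower members (∈-filter⁺ F? (complete b) Fb)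
    where
      members : List Carrier
      members = filter F? xs

  -- A finite H is enumerated by a list and has decidable equality, so
  -- membership in G_a (an equation) is decidable.
  module Finite (finite : IsFinite H) where
    open Inverse (proj₂ finite) using (to; from; strictlyInverseʳ)

    enumeration : List Carrier
    enumeration = tabulate from

    enumeration-complete : ∀ x → x ∈ enumeration
    enumeration-complete x = subst (_∈ enumeration) (strictlyInverseʳ x) (∈-tabulate⁺ (to x))

    G-decidable : ∀ a → Decidable (G[ H ] a)
    G-decidable a b = inj⇒≟ (↔⇒↣ (proj₂ finite)) _ _

    G-minimum : ∀ a → Σ Carrier (IsMinimum H (G[ H ] a))
    G-minimum a = filter-minimum (G-filter a) (G-decidable a) enumeration enumeration-complete

  minimum-GFunction : (G : ∀ a → Σ Carrier (IsMinimum H (G[ H ] a)))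
    → IsGFunction H (λ a → proj₁ (G a))
  minimum-GFunction G = record
    { extensive = extensive ; peirce = peirce ; below-¬¬ = below-¬¬ ; imp-cond = imp-cond }
    where
      g : Carrier → Carrier
      g a = proj₁ (G a)

      g∈G : ∀ a → G[ H ] a (g a)
      g∈G a = proj₁ (proj₂ (G a))

      g-least : ∀ a b → G[ H ] a b → g a ≤ b
      g-least a = proj₂ (proj₂ (G a))

      -- a passes the test for g(a).
      extensive : ∀ a → a ≤ g a
      extensive a = G-elim (g∈G a) (≤-¬¬ a) (∧-lowerˡ a (g a))

      -- Peirce's element ((b → a) → b) → b lies in G_a: a test element z
      -- satisfies z ≤ b → a (since b is below Peirce's element), hence
      -- z ∧ ((b → a) → b) ≤ b.
      peirce : ∀ a b → g a ≤ ((b ⇒ a) ⇒ b) ⇒ b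
      peirce a b = g-least a _ (G-intro λ {z} _ z∧p≤a →
        let z≤b⇒a : z ≤ b ⇒ a
            z≤b⇒a = curry (≤-trans (∧-mono (≤-refl z) (weaken b ((b ⇒ a) ⇒ b))) z∧p≤a)
        in curry (≤-trans (∧-mono z≤b⇒a (≤-refl _)) (modus-ponens′ (b ⇒ a) b)))

      -- ¬¬a ∈ G_a trivially.
      below-¬¬ : ∀ a → g a ≤ ∼ (∼ a)
      below-¬¬ a = g-least a _ (∧-lowerˡ _ _)

      -- w = (g a → a) ∧ ¬¬a passes the test for g(a), so w ≤ g(a) ∧ (g a → a) ≤ a.
      imp-cond : ∀ a → (g a ⇒ a) ≤ (∼ (∼ a) ⇒ a)
      imp-cond a = curry (≤-trans (∧-greatest w≤g (∧-lowerˡ _ _)) (modus-ponens′ (g a) a))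
        where
          w≤g : (g a ⇒ a) ∧ ∼ (∼ a) ≤ g a
          w≤g = G-elim (g∈G a) (∧-lowerʳ _ _)
                  (≤-trans (∧-mono (∧-lowerˡ _ _) (≤-refl (g a))) (modus-ponens (g a) a))

proposition6p1 : {c : Level} (H : BoundedImplicativeSemilattice c)
    → (∀ a → IsFilter H (G[_] H a))
      × (IsFinite H
         → (∀ a → Σ (BoundedImplicativeSemilattice.Carrier H) (IsMinimum H (G[_] H a)))
           × Σ (BoundedImplicativeSemilattice.Carrier H → BoundedImplicativeSemilattice.Carrier H) (IsGFunction H))
proposition6p1 H = G-filter H , λ finite →
  let open Finite H finite in
  G-minimum , (λ a → proj₁ (G-minimum a)) , minimum-GFunction H G-minimum
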